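{- Let $(X,\leq,\top,\ominus)$ be a D-poset with canonical sum $\oplus$, and let $i<j$ be natural numbers; put $k=j-i$. Let $C_m$ be the set of monotone functions $[2m]\to X$ ($[m]=\{0<\dots<m\}$). Define $s,t:C_j\to C_i$ by $s(f)(p)=f(p)$ for $0\leq p\leq i$, $s(f)(p)=f(p+2k)$ for $i<p\leq 2i$; $t(f)(p)=f(p)$ for $0\leq p<i$, $t(f)(p)=f(p+2k)$ for $i\leq p\leq 2i$. Define $Id:C_i\to C_j$ by $Id(a)(p)=a(p)$ for $0\leq p<i$, $Id(a)(p)=a(i)$ for $i\leq p\leq i+2k$, $Id(a)(p)=a(p-2k)$ for $i+2k<p\leq 2j$. For $f,g\in C_j$ with $s(f)=t(g)$ define $c(f,g)(p)=g(p)$ for $p\leq i$, $c(f,g)(p)=(f(p)\ominus f(i))\oplus g(p)$ for $i<p<i+2k$, $c(f,g)(p)=f(p)$ for $p\geq i+2k$. Then there is a category whose set of objects is $C_i$, whose set of morphisms is $C_j$, with source map $s$, target map $t$, identities $Id$ and composition $c$ (where $c(f,g)$ is "$f$ after $g$").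
   Context: A D-poset $(X,\leq,\top,\ominus)$ is a poset with top element $\top$ and a partial binary operation $\ominus$ such that: (1) $y\ominus x$ is defined precisely when $x\leq y$; (2) whenever $x\leq y$, $y\ominus x\leq y$ and $y\ominus(y\ominus x)=x$; (3) if $z\leq y\leq x$ then $x\ominus y\leq x\ominus z$ and $(x\ominus z)\ominus(x\ominus y)=y\ominus z$. The canonical sum: $a\oplus b$ is defined iff there is $c$ with $c\ominus b=a$ (equivalently iff $b\leq\top\ominus a$), and then $a\oplus b:=c$. -}

module Defs where

open import Level using (Level; _⊔_) renaming (suc to lsuc)
open import Data.Nat as ℕ using (ℕ; suc; _+_; _*_; _∸_; _≤?_; _<?_; s≤s)
open import Data.Fin as Fin using (Fin; toℕ; fromℕ; fromℕ<)
open import Data.Product using (Σ; _×_; _,_; proj₁)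
open import Relation.Nullary using (yes; no)
open import Relation.Binary.PropositionalEquality using (_≡_)
open import Relation.Binary.Structures using (IsPartialOrder)

-- A D-poset (X, ≤, top, ⊖).  The partial operation y ⊖ x is modelled as a
-- total operation taking an (irrelevant) proof of x ≤ y, so it is defined
-- precisely when x ≤ y.
record DPoset (c ℓ : Level) : Set (lsuc (c ⊔ ℓ)) where
  infix 4 _≤_
  field
    Carrier        : Set c
    _≤_            : Carrier → Carrier → Set ℓ
    isPartialOrder : IsPartialOrder _≡_ _≤_
    top            : Carrier
    top-max        : ∀ x → x ≤ top
    _⊖_            : (y x : Carrier) → .(x ≤ y) → Carrier
    ⊖-≤            : ∀ {x y} (h : x ≤ y) → (y ⊖ x) h ≤ y
    ⊖-inv          : ∀ {x y} (h : x ≤ y) → (y ⊖ ((y ⊖ x) h)) (⊖-≤ h) ≡ x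
    ⊖-anti         : ∀ {x y z} (zy : z ≤ y) (yx : y ≤ x) →
                     (x ⊖ y) yx ≤ (x ⊖ z) (IsPartialOrder.trans isPartialOrder zy yx)
    ⊖-diff         : ∀ {x y z} (zy : z ≤ y) (yx : y ≤ x) →
                     ((x ⊖ z) (IsPartialOrder.trans isPartialOrder zy yx) ⊖ (x ⊖ y) yx) (⊖-anti zy yx)
                       ≡ (y ⊖ z) zy

module _ {c ℓ : Level} (D : DPoset c ℓ) where
  open DPoset D

  -- canonical sum, as a relation: IsSum a b c  means  "a ⊕ b is defined and equals c",
  -- i.e. c ⊖ b = a.
  IsSum : Carrier → Carrier → Carrier → Set (c ⊔ ℓ)
  IsSum a b x = Σ (b ≤ x) λ h → (x ⊖ b) h ≡ a

  Raw : ℕ → Set c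
  Raw m = Fin (suc (2 * m)) → Carrier

  Monotone : ∀ m → Raw m → Set ℓ
  Monotone m f = ∀ p q → p Fin.≤ q → f p ≤ f q

  record C (m : ℕ) : Set (c ⊔ ℓ) where
    constructor mk
    field
      fun  : Raw m
      mono : Monotone m fun
  open C public

  PwEq : ∀ m → Raw m → Raw m → Set c
  PwEq m f g = (p : Fin (suc (2 * m))) → f p ≡ g p

  _≈_ : ∀ {m} → C m → C m → Set c
  _≈_ {m} f g = PwEq m (fun f) (fun g)

  -- evaluation at a natural number index (only ever used at indices ≤ 2m;
  -- out-of-range indices are clamped, which never happens below)
  ev : ∀ m → Raw m → ℕ → Carrier
  ev m f n with n ≤? 2 * m
  ... | yes n≤ = f (fromℕ< (s≤s n≤))
  ... | no _   = f (fromℕ (2 * m))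

  module _ (i j : ℕ) where
    k : ℕ
    k = j ∸ i

    sRaw : Raw j → Raw i
    sRaw f p with toℕ p ≤? i
    ... | yes _ = ev j f (toℕ p)
    ... | no _  = ev j f (toℕ p + 2 * k)

    tRaw : Raw j → Raw i
    tRaw f p with toℕ p <? i
    ... | yes _ = ev j f (toℕ p)
    ... | no _  = ev j f (toℕ p + 2 * k)

    IdRaw : Raw i → Raw j
    IdRaw a p with toℕ p <? i | toℕ p ≤? i + 2 * k
    ... | yes _ | _     = ev i a (toℕ p)
    ... | no _  | yes _ = ev i a i
    ... | no _  | no _  = ev i a (toℕ p ∸ 2 * k)

    -- h = c(f,g), pointwise specification (requires f i ≤ f p for the ⊖,
    -- supplied by monotonicity of f)
    CompSpec : (f g h : C j) → Set (c ⊔ ℓ)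
    CompSpec (mk f _) (mk g _) (mk h _) =
      (∀ p → toℕ p ℕ.≤ i → h p ≡ g p) ×
      (∀ p → i ℕ.< toℕ p → toℕ p ℕ.< i + 2 * k → (le : ev j f i ≤ f p) →
         IsSum ((f p ⊖ ev j f i) le) (g p) (h p)) ×
      (∀ p → i + 2 * k ℕ.≤ toℕ p → h p ≡ f p)

    -- Equality of objects/morphisms is equality of
    -- functions, i.e. pointwise equality.
    record IsDCategory : Set (c ⊔ ℓ) where
      field
        src      : C j → C i
        src-def  : ∀ f → PwEq i (fun (src f)) (sRaw (fun f))
        tgt      : C j → C i
        tgt-def  : ∀ f → PwEq i (fun (tgt f)) (tRaw (fun f))
        idm      : C i → C j
        idm-def  : ∀ a → PwEq j (fun (idm a)) (IdRaw (fun a))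
        comp     : (f g : C j) → src f ≈ tgt g → C j
        comp-def : ∀ f g (e : src f ≈ tgt g) → CompSpec f g (comp f g e)
        src-idm  : ∀ a → src (idm a) ≈ a
        tgt-idm  : ∀ a → tgt (idm a) ≈ a
        src-comp : ∀ f g (e : src f ≈ tgt g) → src (comp f g e) ≈ src g
        tgt-comp : ∀ f g (e : src f ≈ tgt g) → tgt (comp f g e) ≈ tgt f
        id-right : ∀ f (e : src f ≈ tgt (idm (src f))) → comp f (idm (src f)) e ≈ f
        id-left  : ∀ f (e : src (idm (tgt f)) ≈ tgt f) → comp (idm (tgt f)) f e ≈ f
        assoc    : ∀ f g h (e₁ : src f ≈ tgt g) (e₂ : src g ≈ tgt h)
                   (e₃ : src (comp f g e₁) ≈ tgt h) (e₄ : src f ≈ tgt (comp g h e₂)) →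
                   comp (comp f g e₁) h e₃ ≈ comp f (comp g h e₂) e₄

-- The maps s, t and Id are precompositions with monotone maps of index sets:
-- s f = f ∘ s-index and t f = f ∘ t-index, where s-index, t-index : [2i] → [2j]
-- jump over the half-open blocks (i, i+2k] resp. [i, i+2k), and Id a = a ∘ id-index,
-- where id-index : [2j] → [2i] collapses [i, i+2k] to i.  The laws for the source and
-- target of an identity are then the identities id-index ∘ s-index = id-index ∘ t-index = id.
-- The composite c(f,g) agrees with g up to i and with f from i+2k on; in between it is
-- (f p ⊖ f i) ⊕ g p, which is defined because s f = t g forces g p ≤ g (i+2k) = f i.
-- The unit laws reduce to (x ⊖ b) ⊕ b = x and (x ⊖ x) ⊕ b = b, and associativity on the
-- middle block to ((a ⊕ b) ⊖ c) ⊕ d = a ⊕ ((b ⊖ c) ⊕ d) for d ≤ c ≤ b.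
module Submission where

open import Defs
open import Level using (Level)
open import Data.Nat using (ℕ; _<_; _+_; _*_; _∸_; _≤?_; _<?_; s≤s)
import Data.Nat as ℕ
import Data.Nat.Properties as ℕₚ
open import Data.Fin using (toℕ; fromℕ<)
import Data.Fin.Properties as Finₚ
open import Data.Product using (_,_)
open import Data.Sum using (inj₁; inj₂)
open import Data.Empty using (⊥-elim)
open import Function using (_∘_)
open import Relation.Nullary using (yes; no)
open import Relation.Binary.Core using (_Preserves_⟶_)
open import Relation.Binary.Structures using (IsPartialOrder)
open import Relation.Binary.PropositionalEquality
  using (_≡_; refl; sym; trans; cong; subst; subst₂; module ≡-Reasoning)

module DPosetProperties {ℓ₁ ℓ₂ : Level} (D : DPoset ℓ₁ ℓ₂) where
  open DPoset D
  open IsPartialOrder isPartialOrder using () renaming (refl to ≤-refl; trans to ≤-trans)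

  ⊖-cong : ∀ {y y′ x x′} → y ≡ y′ → x ≡ x′ → .(h : x ≤ y) .(h′ : x′ ≤ y′) →
           (y ⊖ x) h ≡ (y′ ⊖ x′) h′
  ⊖-cong refl refl _ _ = refl

  infix 25 ⊤⊖_
  ⊤⊖_ : Carrier → Carrier
  ⊤⊖ x = (top ⊖ x) (top-max x)

  ⊤⊖-involutive : ∀ x → ⊤⊖ ⊤⊖ x ≡ x
  ⊤⊖-involutive x = ⊖-inv (top-max x)

  ⊤⊖-antitone : ∀ {x y} → x ≤ y → ⊤⊖ y ≤ ⊤⊖ x
  ⊤⊖-antitone x≤y = ⊖-anti x≤y (top-max _)

  ⊖-monoˡ-≤ : ∀ {x y z} (z≤x : z ≤ x) (x≤y : x ≤ y) → (x ⊖ z) z≤x ≤ (y ⊖ z) (≤-trans z≤x x≤y)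
  ⊖-monoˡ-≤ z≤x x≤y = subst₂ _≤_ (⊖-diff z≤x x≤y) refl (⊖-≤ (⊖-anti z≤x x≤y))

  ⊖-≤-⊤⊖ : ∀ {x y z} (z≤y : z ≤ y) (y≤x : y ≤ x) → (x ⊖ y) y≤x ≤ ⊤⊖ z
  ⊖-≤-⊤⊖ z≤y y≤x = ≤-trans (⊖-anti z≤y y≤x) (⊖-monoˡ-≤ (≤-trans z≤y y≤x) (top-max _))

  ⊖-⊖-cancelʳ : ∀ {x y z} (z≤y : z ≤ y) (y≤x : y ≤ x) →
                ((x ⊖ z) (≤-trans z≤y y≤x) ⊖ (y ⊖ z) z≤y) (⊖-monoˡ-≤ z≤y y≤x) ≡ (x ⊖ y) y≤x
  ⊖-⊖-cancelʳ z≤y y≤x =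
    trans (⊖-cong refl (sym (⊖-diff z≤y y≤x)) _ (⊖-≤ (⊖-anti z≤y y≤x))) (⊖-inv (⊖-anti z≤y y≤x))

  -- The canonical sum in closed form; a ⊕ b [ p ] is the unique x with x ⊖ b = a (⊕-unique).
  infixl 6 _⊕_[_]
  _⊕_[_] : (a b : Carrier) → .(a ≤ ⊤⊖ b) → Carrier
  a ⊕ b [ p ] = ⊤⊖ (⊤⊖ b ⊖ a) p

  ⊕-cong : ∀ {a a′ b b′} → a ≡ a′ → b ≡ b′ → .(p : a ≤ ⊤⊖ b) .(p′ : a′ ≤ ⊤⊖ b′) →
           a ⊕ b [ p ] ≡ a′ ⊕ b′ [ p′ ]
  ⊕-cong refl refl _ _ = refl

  b≤a⊕b : ∀ {a b} (p : a ≤ ⊤⊖ b) → b ≤ a ⊕ b [ p ]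
  b≤a⊕b {b = b} p = subst₂ _≤_ (⊤⊖-involutive b) refl (⊤⊖-antitone (⊖-≤ p))

  a⊕b⊖b≡a : ∀ {a b} (p : a ≤ ⊤⊖ b) → ((a ⊕ b [ p ]) ⊖ b) (b≤a⊕b p) ≡ a
  a⊕b⊖b≡a {a} {b} p = begin
    ((a ⊕ b [ p ]) ⊖ b) _                                ≡⟨ sym (⊖-diff (b≤a⊕b p) (top-max _)) ⟩
    (⊤⊖ b ⊖ ⊤⊖ (a ⊕ b [ p ])) _                        ≡⟨ ⊖-cong refl (⊤⊖-involutive _) _ (⊖-≤ p) ⟩
    (⊤⊖ b ⊖ (⊤⊖ b ⊖ a) p) _                            ≡⟨ ⊖-inv p ⟩
    a                                                  ∎
    where open ≡-Reasoning

  IsSum-resp-≡ : ∀ {a a′ b b′ x x′} → a ≡ a′ → b ≡ b′ → x ≡ x′ → IsSum D a b x → IsSum D a′ b′ x′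
  IsSum-resp-≡ refl refl refl a⊕b≡x = a⊕b≡x

  ⊕-isSum : ∀ {a b} (p : a ≤ ⊤⊖ b) → IsSum D a b (a ⊕ b [ p ])
  ⊕-isSum p = b≤a⊕b p , a⊕b⊖b≡a p

  ⊕-unique : ∀ {a b x} (b≤x : b ≤ x) → (x ⊖ b) b≤x ≡ a → .(p : a ≤ ⊤⊖ b) → a ⊕ b [ p ] ≡ x
  ⊕-unique {a} {b} {x} b≤x x⊖b≡a p = begin
    ⊤⊖ (⊤⊖ b ⊖ a) p                                  ≡⟨ cong ⊤⊖_ (⊖-cong refl a≡ p _) ⟩
    ⊤⊖ (⊤⊖ b ⊖ (⊤⊖ b ⊖ ⊤⊖ x) (⊤⊖-antitone b≤x)) _   ≡⟨ cong ⊤⊖_ (⊖-inv (⊤⊖-antitone b≤x)) ⟩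
    ⊤⊖ ⊤⊖ x                                          ≡⟨ ⊤⊖-involutive x ⟩
    x                                                ∎
    where
    open ≡-Reasoning
    a≡ : a ≡ (⊤⊖ b ⊖ ⊤⊖ x) (⊤⊖-antitone b≤x)
    a≡ = sym (trans (⊖-diff b≤x (top-max x)) x⊖b≡a)

  [x⊖b]⊕b≡x : ∀ {b x} (b≤x : b ≤ x) .(p : (x ⊖ b) b≤x ≤ ⊤⊖ b) → (x ⊖ b) b≤x ⊕ b [ p ] ≡ x
  [x⊖b]⊕b≡x b≤x = ⊕-unique b≤x refl

  𝟎 : Carrier
  𝟎 = ⊤⊖ top

  𝟎≤x : ∀ x → 𝟎 ≤ x
  𝟎≤x x = subst₂ _≤_ refl (⊤⊖-involutive x) (⊖-anti (top-max (⊤⊖ x)) ≤-refl)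

  x⊖𝟎≡x : ∀ x → (x ⊖ 𝟎) (𝟎≤x x) ≡ x
  x⊖𝟎≡x x = begin
    (x ⊖ 𝟎) _                    ≡⟨ ⊖-cong (sym (⊤⊖-involutive x)) refl _ _ ⟩
    (⊤⊖ ⊤⊖ x ⊖ 𝟎) _              ≡⟨ ⊖-diff (top-max (⊤⊖ x)) ≤-refl ⟩
    ⊤⊖ ⊤⊖ x                      ≡⟨ ⊤⊖-involutive x ⟩
    x                            ∎
    where open ≡-Reasoning

  x⊖x≡𝟎 : ∀ x → (x ⊖ x) ≤-refl ≡ 𝟎
  x⊖x≡𝟎 x = trans (⊖-cong refl (sym (x⊖𝟎≡x x)) _ _) (⊖-inv (𝟎≤x x))

  [x⊖x]⊕b≡b : ∀ {x b} .(p : (x ⊖ x) ≤-refl ≤ ⊤⊖ b) → (x ⊖ x) ≤-refl ⊕ b [ p ] ≡ b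
  [x⊖x]⊕b≡b {x} {b} = ⊕-unique ≤-refl (trans (x⊖x≡𝟎 b) (sym (x⊖x≡𝟎 x)))

  ⊕-mono-≤ : ∀ {a a′ b b′} (a≤a′ : a ≤ a′) (b≤b′ : b ≤ b′) (p′ : a′ ≤ ⊤⊖ b′) .(p : a ≤ ⊤⊖ b) →
             a ⊕ b [ p ] ≤ a′ ⊕ b′ [ p′ ]
  ⊕-mono-≤ a≤a′ b≤b′ p′ p =
    ⊤⊖-antitone (≤-trans (⊖-anti a≤a′ p′) (⊖-monoˡ-≤ (≤-trans a≤a′ p′) (⊤⊖-antitone b≤b′)))

  [x⊖y]⊕z≤x : ∀ {x y z} (z≤y : z ≤ y) (y≤x : y ≤ x) .(p : (x ⊖ y) y≤x ≤ ⊤⊖ z) →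
              (x ⊖ y) y≤x ⊕ z [ p ] ≤ x
  [x⊖y]⊕z≤x z≤y y≤x p =
    subst₂ _≤_ refl ([x⊖b]⊕b≡x y≤x p′) (⊕-mono-≤ ≤-refl z≤y p′ p)
    where p′ = ⊖-≤-⊤⊖ ≤-refl y≤x

  ⊕-⊖-assoc : ∀ {a b c} (c≤b : c ≤ b) (p : a ≤ ⊤⊖ b) .(q : a ≤ ⊤⊖ (b ⊖ c) c≤b) →
              ((a ⊕ b [ p ]) ⊖ c) (≤-trans c≤b (b≤a⊕b p)) ≡ a ⊕ (b ⊖ c) c≤b [ q ]
  ⊕-⊖-assoc c≤b p q =
    sym (⊕-unique (⊖-monoˡ-≤ c≤b (b≤a⊕b p)) (trans (⊖-⊖-cancelʳ c≤b (b≤a⊕b p)) (a⊕b⊖b≡a p)) q)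

  ⊕-assoc : ∀ {a b c} (q : b ≤ ⊤⊖ c) (r : a ≤ ⊤⊖ (b ⊕ c [ q ]))
            .(p : a ≤ ⊤⊖ b) .(s : a ⊕ b [ p ] ≤ ⊤⊖ c) →
            (a ⊕ b [ p ]) ⊕ c [ s ] ≡ a ⊕ (b ⊕ c [ q ]) [ r ]
  ⊕-assoc {a} {b} {c} q r p s = begin
    (a ⊕ b [ p ]) ⊕ c [ s ]      ≡⟨ ⊕-cong a⊕b≡x⊖c refl s (⊖-≤-⊤⊖ ≤-refl c≤x) ⟩
    (x ⊖ c) c≤x ⊕ c [ _ ]        ≡⟨ [x⊖b]⊕b≡x c≤x _ ⟩
    x                            ∎
    where
    open ≡-Reasoning
    x = a ⊕ (b ⊕ c [ q ]) [ r ]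
    c≤x : c ≤ x
    c≤x = ≤-trans (b≤a⊕b q) (b≤a⊕b r)
    x⊖c⊖b≡a : ((x ⊖ c) c≤x ⊖ b) _ ≡ a
    x⊖c⊖b≡a = begin
      ((x ⊖ c) c≤x ⊖ b) _                              ≡⟨ ⊖-cong refl (sym (a⊕b⊖b≡a q)) _ _ ⟩
      ((x ⊖ c) c≤x ⊖ ((b ⊕ c [ q ]) ⊖ c) (b≤a⊕b q)) _  ≡⟨ ⊖-⊖-cancelʳ (b≤a⊕b q) (b≤a⊕b r) ⟩
      (x ⊖ (b ⊕ c [ q ])) (b≤a⊕b r)                    ≡⟨ a⊕b⊖b≡a r ⟩
      a                                                ∎
    a⊕b≡x⊖c : a ⊕ b [ p ] ≡ (x ⊖ c) c≤x
    a⊕b≡x⊖c = ⊕-unique (subst₂ _≤_ (a⊕b⊖b≡a q) refl (⊖-monoˡ-≤ (b≤a⊕b q) (b≤a⊕b r))) x⊖c⊖b≡a p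

  ⊕-⊖-⊕-assoc : ∀ {a b c d} (d≤c : d ≤ c) (c≤b : c ≤ b) (p : a ≤ ⊤⊖ b) →
                ((a ⊕ b [ p ]) ⊖ c) (≤-trans c≤b (b≤a⊕b p)) ⊕ d [ ⊖-≤-⊤⊖ d≤c (≤-trans c≤b (b≤a⊕b p)) ]
                  ≡ a ⊕ ((b ⊖ c) c≤b ⊕ d [ ⊖-≤-⊤⊖ d≤c c≤b ])
                      [ ≤-trans p (⊤⊖-antitone ([x⊖y]⊕z≤x d≤c c≤b (⊖-≤-⊤⊖ d≤c c≤b))) ]
  ⊕-⊖-⊕-assoc {a} {b} {c} {d} d≤c c≤b p = begin
    ((a ⊕ b [ p ]) ⊖ c) _ ⊕ d [ _ ]      ≡⟨ ⊕-cong (⊕-⊖-assoc c≤b p q) refl _ a⊕[b⊖c]≤⊤⊖d ⟩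
    (a ⊕ (b ⊖ c) c≤b [ q ]) ⊕ d [ _ ]    ≡⟨ ⊕-assoc (⊖-≤-⊤⊖ d≤c c≤b) r q a⊕[b⊖c]≤⊤⊖d ⟩
    a ⊕ ((b ⊖ c) c≤b ⊕ d [ _ ]) [ _ ]    ∎
    where
    open ≡-Reasoning
    q : a ≤ ⊤⊖ (b ⊖ c) c≤b
    q = ≤-trans p (⊤⊖-antitone (⊖-≤ c≤b))
    r = ≤-trans p (⊤⊖-antitone ([x⊖y]⊕z≤x d≤c c≤b (⊖-≤-⊤⊖ d≤c c≤b)))
    a⊕[b⊖c]≤⊤⊖d : a ⊕ (b ⊖ c) c≤b [ q ] ≤ ⊤⊖ d
    a⊕[b⊖c]≤⊤⊖d = subst (_≤ ⊤⊖ d) (⊕-⊖-assoc c≤b p q) (⊖-≤-⊤⊖ d≤c (≤-trans c≤b (b≤a⊕b p)))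

module Evaluation {ℓ₁ ℓ₂ : Level} (D : DPoset ℓ₁ ℓ₂) where
  open DPoset D
  open IsPartialOrder isPartialOrder using () renaming (refl to ≤-refl)

  ev-fromℕ< : ∀ m (r : Raw D m) {n} (n≤2m : n ℕ.≤ 2 * m) → ev D m r n ≡ r (fromℕ< (s≤s n≤2m))
  ev-fromℕ< m r {n} n≤2m with n ≤? 2 * m
  ... | yes _    = refl
  ... | no n≰2m = ⊥-elim (n≰2m n≤2m)

  ev-toℕ : ∀ m (r : Raw D m) p → ev D m r (toℕ p) ≡ r p
  ev-toℕ m r p = trans (ev-fromℕ< m r (Finₚ.toℕ≤pred[n] p)) (cong r (Finₚ.fromℕ<-toℕ p _))

  ev-∘toℕ : ∀ m (R : ℕ → Carrier) {n} → n ℕ.≤ 2 * m → ev D m (λ p → R (toℕ p)) n ≡ R n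
  ev-∘toℕ m R n≤2m = trans (ev-fromℕ< m _ n≤2m) (cong R (Finₚ.toℕ-fromℕ< _))

  -- Out-of-range indices are clamped to 2m, so this needs no bound on n′.
  ev-mono : ∀ m (r : Raw D m) → Monotone D m r → ∀ {n n′} → n ℕ.≤ n′ → ev D m r n ≤ ev D m r n′
  ev-mono m r r-mono {n} {n′} n≤n′ with n ≤? 2 * m | n′ ≤? 2 * m
  ... | yes _    | yes _    =
    r-mono _ _ (subst₂ ℕ._≤_ (sym (Finₚ.toℕ-fromℕ< _)) (sym (Finₚ.toℕ-fromℕ< _)) n≤n′)
  ... | yes n≤2m | no _     =
    r-mono _ _ (subst₂ ℕ._≤_ (sym (Finₚ.toℕ-fromℕ< _)) (sym (Finₚ.toℕ-fromℕ (2 * m))) n≤2m)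
  ... | no n≰2m  | yes n′≤2m = ⊥-elim (n≰2m (ℕₚ.≤-trans n≤n′ n′≤2m))
  ... | no _     | no _     = ≤-refl

  pwEq-fromEv : ∀ m {r r′ : Raw D m} → (∀ {n} → n ℕ.≤ 2 * m → ev D m r n ≡ ev D m r′ n) →
                PwEq D m r r′
  pwEq-fromEv m {r} {r′} r≗r′ p =
    trans (sym (ev-toℕ m r p)) (trans (r≗r′ (Finₚ.toℕ≤pred[n] p)) (ev-toℕ m r′ p))

  ev-resp-pwEq : ∀ m {r r′ : Raw D m} → PwEq D m r r′ →
                 ∀ {n} → n ℕ.≤ 2 * m → ev D m r n ≡ ev D m r′ n
  ev-resp-pwEq m {r} {r′} r≗r′ n≤2m =
    trans (ev-fromℕ< m r n≤2m) (trans (r≗r′ _) (sym (ev-fromℕ< m r′ n≤2m)))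

  precompose : ∀ {m m′} (σ : ℕ → ℕ) → σ Preserves ℕ._≤_ ⟶ ℕ._≤_ → C D m′ → C D m
  precompose {m′ = m′} σ σ-mono f =
    mk (λ p → ev D m′ (fun f) (σ (toℕ p))) (λ p q p≤q → ev-mono m′ (fun f) (mono f) (σ-mono p≤q))

module Reindexing (i K : ℕ) where

  s-index : ℕ → ℕ
  s-index n with n ≤? i
  ... | yes _ = n
  ... | no _  = n + K

  t-index : ℕ → ℕ
  t-index n with n <? i
  ... | yes _ = n
  ... | no _  = n + K

  data IdCase (n : ℕ) : Set where
    below  : n < i → IdCase n
    within : i ℕ.≤ n → n ℕ.≤ i + K → IdCase n
    above  : i + K < n → IdCase n

  idCase : ∀ n → IdCase n
  idCase n with n <? i | n ≤? i + K
  ... | yes n<i | _         = below n<i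
  ... | no n≮i  | yes n≤i+K = within (ℕₚ.≮⇒≥ n≮i) n≤i+K
  ... | no _    | no n≰i+K  = above (ℕₚ.≰⇒> n≰i+K)

  id-index : ℕ → ℕ
  id-index n with idCase n
  ... | below _    = n
  ... | within _ _ = i
  ... | above _    = n ∸ K

  s-index-≤ : ∀ {n} → n ℕ.≤ i → s-index n ≡ n
  s-index-≤ {n} n≤i with n ≤? i
  ... | yes _   = refl
  ... | no n≰i = ⊥-elim (n≰i n≤i)

  s-index-> : ∀ {n} → i < n → s-index n ≡ n + K
  s-index-> {n} i<n with n ≤? i
  ... | yes n≤i = ⊥-elim (ℕₚ.<⇒≱ i<n n≤i)
  ... | no _    = refl

  t-index-< : ∀ {n} → n < i → t-index n ≡ n
  t-index-< {n} n<i with n <? i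
  ... | yes _   = refl
  ... | no n≮i = ⊥-elim (n≮i n<i)

  t-index-≥ : ∀ {n} → i ℕ.≤ n → t-index n ≡ n + K
  t-index-≥ {n} i≤n with n <? i
  ... | yes n<i = ⊥-elim (ℕₚ.<⇒≱ n<i i≤n)
  ... | no _    = refl

  id-index-≤ : ∀ {n} → n ℕ.≤ i → id-index n ≡ n
  id-index-≤ {n} n≤i with idCase n
  ... | below _      = refl
  ... | within i≤n _ = ℕₚ.≤-antisym i≤n n≤i
  ... | above i+K<n  = ⊥-elim (ℕₚ.<⇒≱ i+K<n (ℕₚ.≤-trans n≤i (ℕₚ.m≤m+n i K)))

  id-index-within : ∀ {n} → i ℕ.≤ n → n ℕ.≤ i + K → id-index n ≡ i
  id-index-within {n} i≤n n≤i+K with idCase n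
  ... | below n<i    = ⊥-elim (ℕₚ.<⇒≱ n<i i≤n)
  ... | within _ _   = refl
  ... | above i+K<n  = ⊥-elim (ℕₚ.<⇒≱ i+K<n n≤i+K)

  id-index-> : ∀ {n} → i + K < n → id-index n ≡ n ∸ K
  id-index-> {n} i+K<n with idCase n
  ... | below n<i      = ⊥-elim (ℕₚ.<⇒≱ n<i (ℕₚ.≤-trans (ℕₚ.m≤m+n i K) (ℕₚ.<⇒≤ i+K<n)))
  ... | within _ n≤i+K = ⊥-elim (ℕₚ.<⇒≱ i+K<n n≤i+K)
  ... | above _        = refl

  s-index-mono : s-index Preserves ℕ._≤_ ⟶ ℕ._≤_
  s-index-mono {n} {n′} n≤n′ with n ≤? i | n′ ≤? i
  ... | yes _   | yes _    = n≤n′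
  ... | yes _   | no _     = ℕₚ.≤-trans n≤n′ (ℕₚ.m≤m+n n′ K)
  ... | no n≰i  | yes n′≤i = ⊥-elim (n≰i (ℕₚ.≤-trans n≤n′ n′≤i))
  ... | no _    | no _     = ℕₚ.+-monoˡ-≤ K n≤n′

  t-index-mono : t-index Preserves ℕ._≤_ ⟶ ℕ._≤_
  t-index-mono {n} {n′} n≤n′ with n <? i | n′ <? i
  ... | yes _   | yes _    = n≤n′
  ... | yes _   | no _     = ℕₚ.≤-trans n≤n′ (ℕₚ.m≤m+n n′ K)
  ... | no n≮i  | yes n′<i = ⊥-elim (n≮i (ℕₚ.≤-<-trans n≤n′ n′<i))
  ... | no _    | no _     = ℕₚ.+-monoˡ-≤ K n≤n′

  id-index-mono : id-index Preserves ℕ._≤_ ⟶ ℕ._≤_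
  id-index-mono {n} {n′} n≤n′ with idCase n | idCase n′
  ... | below _      | below _         = n≤n′
  ... | below n<i    | within _ _      = ℕₚ.<⇒≤ n<i
  ... | below n<i    | above i+K<n′    = ℕₚ.≤-trans (ℕₚ.<⇒≤ n<i) (ℕₚ.m+n≤o⇒m≤o∸n i (ℕₚ.<⇒≤ i+K<n′))
  ... | within i≤n _ | below n′<i      = ⊥-elim (ℕₚ.<⇒≱ n′<i (ℕₚ.≤-trans i≤n n≤n′))
  ... | within _ _   | within _ _      = ℕₚ.≤-refl
  ... | within _ _   | above i+K<n′    = ℕₚ.m+n≤o⇒m≤o∸n i (ℕₚ.<⇒≤ i+K<n′)
  ... | above i+K<n  | below n′<i      =
    ⊥-elim (ℕₚ.<⇒≱ n′<i (ℕₚ.≤-trans (ℕₚ.m≤m+n i K) (ℕₚ.≤-trans (ℕₚ.<⇒≤ i+K<n) n≤n′)))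
  ... | above i+K<n  | within _ n′≤i+K = ⊥-elim (ℕₚ.<⇒≱ i+K<n (ℕₚ.≤-trans n≤n′ n′≤i+K))
  ... | above _      | above _         = ℕₚ.∸-monoˡ-≤ K n≤n′

  s-index-bounded : ∀ {n m} → n ℕ.≤ m → s-index n ℕ.≤ m + K
  s-index-bounded {n} n≤m with n ≤? i
  ... | yes _ = ℕₚ.≤-trans n≤m (ℕₚ.m≤m+n _ K)
  ... | no _  = ℕₚ.+-monoˡ-≤ K n≤m

  t-index-bounded : ∀ {n m} → n ℕ.≤ m → t-index n ℕ.≤ m + K
  t-index-bounded {n} n≤m with n <? i
  ... | yes _ = ℕₚ.≤-trans n≤m (ℕₚ.m≤m+n _ K)
  ... | no _  = ℕₚ.+-monoˡ-≤ K n≤m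

  id-index-bounded : ∀ {n m} → i ℕ.≤ m → n ℕ.≤ m + K → id-index n ℕ.≤ m
  id-index-bounded {n} {m} i≤m n≤m+K with idCase n
  ... | below n<i  = ℕₚ.≤-trans (ℕₚ.<⇒≤ n<i) i≤m
  ... | within _ _ = i≤m
  ... | above _    = subst (n ∸ K ℕ.≤_) (ℕₚ.m+n∸n≡m m K) (ℕₚ.∸-monoˡ-≤ K n≤m+K)

  id-index∘s-index : ∀ n → id-index (s-index n) ≡ n
  id-index∘s-index n with n ≤? i
  ... | yes n≤i = id-index-≤ n≤i
  ... | no n≰i  = trans (id-index-> (ℕₚ.+-monoˡ-< K (ℕₚ.≰⇒> n≰i))) (ℕₚ.m+n∸n≡m n K)

  id-index∘t-index : ∀ n → id-index (t-index n) ≡ n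
  id-index∘t-index n with n <? i
  ... | yes n<i = id-index-≤ (ℕₚ.<⇒≤ n<i)
  ... | no n≮i with n ≤? i
  ...   | yes n≤i = trans (id-index-within (ℕₚ.≤-trans i≤n (ℕₚ.m≤m+n n K)) (ℕₚ.+-monoˡ-≤ K n≤i))
                          (ℕₚ.≤-antisym i≤n n≤i)
    where i≤n = ℕₚ.≮⇒≥ n≮i
  ...   | no n≰i  = trans (id-index-> (ℕₚ.+-monoˡ-< K (ℕₚ.≰⇒> n≰i))) (ℕₚ.m+n∸n≡m n K)

  s-index∘id-index : ∀ {n} → n ℕ.≤ i → s-index (id-index n) ≡ n
  s-index∘id-index n≤i = trans (cong s-index (id-index-≤ n≤i)) (s-index-≤ n≤i)

  t-index∘id-index : ∀ {n} → i + K ℕ.≤ n → t-index (id-index n) ≡ n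
  t-index∘id-index {n} i+K≤n with ℕₚ.m≤n⇒m<n∨m≡n i+K≤n
  ... | inj₂ refl =
    trans (cong t-index (id-index-within (ℕₚ.m≤m+n i K) ℕₚ.≤-refl)) (t-index-≥ ℕₚ.≤-refl)
  ... | inj₁ i+K<n = begin
    t-index (id-index n)   ≡⟨ cong t-index (id-index-> i+K<n) ⟩
    t-index (n ∸ K)        ≡⟨ t-index-≥ (ℕₚ.m+n≤o⇒m≤o∸n i i+K≤n) ⟩
    n ∸ K + K              ≡⟨ ℕₚ.m∸n+n≡m (ℕₚ.m+n≤o⇒n≤o i i+K≤n) ⟩
    n                      ∎
    where open ≡-Reasoning

  data Band (n : ℕ) : Set where
    lower  : n ℕ.≤ i → Band n
    middle : i < n → n < i + K → Band n
    upper  : i + K ℕ.≤ n → Band n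

  band : ∀ n → Band n
  band n with n ≤? i | n <? i + K
  ... | yes n≤i | _         = lower n≤i
  ... | no n≰i  | yes n<i+K = middle (ℕₚ.≰⇒> n≰i) n<i+K
  ... | no _    | no n≮i+K  = upper (ℕₚ.≮⇒≥ n≮i+K)

module Construction {ℓ₁ ℓ₂ : Level} (D : DPoset ℓ₁ ℓ₂) (i j : ℕ) (i<j : i < j) where
  open DPoset D
  open IsPartialOrder isPartialOrder using () renaming (refl to ≤-refl; trans to ≤-trans)
  open DPosetProperties D
  open Evaluation D

  K : ℕ
  K = 2 * k D i j

  open Reindexing i K

  2j≡2i+K : 2 * j ≡ 2 * i + K
  2j≡2i+K = trans (cong (2 *_) (sym (ℕₚ.m+[n∸m]≡n (ℕₚ.<⇒≤ i<j)))) (ℕₚ.*-distribˡ-+ 2 i (k D i j))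

  i<i+K : i < i + K
  i<i+K = ℕₚ.m<m+n i (ℕₚ.<-≤-trans (ℕₚ.m<n⇒0<n∸m i<j) (ℕₚ.m≤m+n (k D i j) _))

  i≤2i : i ℕ.≤ 2 * i
  i≤2i = ℕₚ.m≤m+n i _

  2i≤2j : 2 * i ℕ.≤ 2 * j
  2i≤2j = subst (2 * i ℕ.≤_) (sym 2j≡2i+K) (ℕₚ.m≤m+n (2 * i) K)

  ≤2i⇒+K≤2j : ∀ {n} → n ℕ.≤ 2 * i → n + K ℕ.≤ 2 * j
  ≤2i⇒+K≤2j {n} n≤2i = subst (n + K ℕ.≤_) (sym 2j≡2i+K) (ℕₚ.+-monoˡ-≤ K n≤2i)

  i+K≤2j : i + K ℕ.≤ 2 * j
  i+K≤2j = ≤2i⇒+K≤2j i≤2i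

  s-index-range : ∀ {n} → n ℕ.≤ 2 * i → s-index n ℕ.≤ 2 * j
  s-index-range {n} n≤2i = subst (s-index n ℕ.≤_) (sym 2j≡2i+K) (s-index-bounded n≤2i)

  t-index-range : ∀ {n} → n ℕ.≤ 2 * i → t-index n ℕ.≤ 2 * j
  t-index-range {n} n≤2i = subst (t-index n ℕ.≤_) (sym 2j≡2i+K) (t-index-bounded n≤2i)

  id-index-range : ∀ {n} → n ℕ.≤ 2 * j → id-index n ℕ.≤ 2 * i
  id-index-range {n} n≤2j = id-index-bounded i≤2i (subst (n ℕ.≤_) 2j≡2i+K n≤2j)

  src tgt : C D j → C D i
  src = precompose s-index s-index-mono
  tgt = precompose t-index t-index-mono

  idm : C D i → C D j
  idm = precompose id-index id-index-mono

  sRaw≗s-index : ∀ r p → sRaw D i j r p ≡ ev D j r (s-index (toℕ p))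
  sRaw≗s-index r p with toℕ p ≤? i
  ... | yes _ = refl
  ... | no _  = refl

  tRaw≗t-index : ∀ r p → tRaw D i j r p ≡ ev D j r (t-index (toℕ p))
  tRaw≗t-index r p with toℕ p <? i
  ... | yes _ = refl
  ... | no _  = refl

  IdRaw≗id-index : ∀ r p → IdRaw D i j r p ≡ ev D i r (id-index (toℕ p))
  IdRaw≗id-index r p with toℕ p <? i | toℕ p ≤? i + K
  ... | yes _ | _     = refl
  ... | no _  | yes _ = refl
  ... | no _  | no _  = refl

  E : C D j → ℕ → Carrier
  E f = ev D j (fun f)

  A : C D i → ℕ → Carrier
  A a = ev D i (fun a)

  E-mono : ∀ f {n n′} → n ℕ.≤ n′ → E f n ≤ E f n′
  E-mono f = ev-mono j (fun f) (mono f)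

  A-src : ∀ f {n} → n ℕ.≤ 2 * i → A (src f) n ≡ E f (s-index n)
  A-src f = ev-∘toℕ i (λ n → E f (s-index n))

  A-tgt : ∀ f {n} → n ℕ.≤ 2 * i → A (tgt f) n ≡ E f (t-index n)
  A-tgt f = ev-∘toℕ i (λ n → E f (t-index n))

  E-idm : ∀ a {n} → n ℕ.≤ 2 * j → E (idm a) n ≡ A a (id-index n)
  E-idm a = ev-∘toℕ j (λ n → A a (id-index n))

  A-src∘idm : ∀ a {n} → n ℕ.≤ 2 * i → A (src (idm a)) n ≡ A a (id-index (s-index n))
  A-src∘idm a n≤2i = trans (A-src (idm a) n≤2i) (E-idm a (s-index-range n≤2i))

  A-tgt∘idm : ∀ a {n} → n ℕ.≤ 2 * i → A (tgt (idm a)) n ≡ A a (id-index (t-index n))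
  A-tgt∘idm a n≤2i = trans (A-tgt (idm a) n≤2i) (E-idm a (t-index-range n≤2i))

  src-idm : ∀ a → _≈_ D (src (idm a)) a
  src-idm a = pwEq-fromEv i λ {n} n≤2i →
    trans (A-src∘idm a n≤2i) (cong (A a) (id-index∘s-index n))

  tgt-idm : ∀ a → _≈_ D (tgt (idm a)) a
  tgt-idm a = pwEq-fromEv i λ {n} n≤2i →
    trans (A-tgt∘idm a n≤2i) (cong (A a) (id-index∘t-index n))

  E-idm∘src : ∀ f {n} → n ℕ.≤ 2 * j → E (idm (src f)) n ≡ E f (s-index (id-index n))
  E-idm∘src f n≤2j = trans (E-idm (src f) n≤2j) (A-src f (id-index-range n≤2j))

  E-idm∘tgt : ∀ f {n} → n ℕ.≤ 2 * j → E (idm (tgt f)) n ≡ E f (t-index (id-index n))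
  E-idm∘tgt f n≤2j = trans (E-idm (tgt f) n≤2j) (A-tgt f (id-index-range n≤2j))

  E-idm∘src-within : ∀ f {n} → i ℕ.≤ n → n ℕ.≤ i + K → n ℕ.≤ 2 * j → E (idm (src f)) n ≡ E f i
  E-idm∘src-within f i≤n n≤i+K n≤2j =
    trans (E-idm∘src f n≤2j)
          (cong (E f) (trans (cong s-index (id-index-within i≤n n≤i+K)) (s-index-≤ ℕₚ.≤-refl)))

  E-idm∘tgt-within : ∀ f {n} → i ℕ.≤ n → n ℕ.≤ i + K → n ℕ.≤ 2 * j → E (idm (tgt f)) n ≡ E f (i + K)
  E-idm∘tgt-within f i≤n n≤i+K n≤2j =
    trans (E-idm∘tgt f n≤2j)
          (cong (E f) (trans (cong t-index (id-index-within i≤n n≤i+K)) (t-index-≥ ℕₚ.≤-refl)))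

  src-cong : ∀ {f f′} → (∀ {n} → n ℕ.≤ 2 * i → E f (s-index n) ≡ E f′ (s-index n)) →
             _≈_ D (src f) (src f′)
  src-cong {f} {f′} f≗f′ = pwEq-fromEv i λ n≤2i →
    trans (A-src f n≤2i) (trans (f≗f′ n≤2i) (sym (A-src f′ n≤2i)))

  tgt-cong : ∀ {f f′} → (∀ {n} → n ℕ.≤ 2 * i → E f (t-index n) ≡ E f′ (t-index n)) →
             _≈_ D (tgt f) (tgt f′)
  tgt-cong {f} {f′} f≗f′ = pwEq-fromEv i λ n≤2i →
    trans (A-tgt f n≤2i) (trans (f≗f′ n≤2i) (sym (A-tgt f′ n≤2i)))

  module Composite (f g : C D j) (src-f≈tgt-g : _≈_ D (src f) (tgt g)) where

    compatible : ∀ {n a b} → n ℕ.≤ 2 * i → s-index n ≡ a → t-index n ≡ b → E f a ≡ E g b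
    compatible n≤2i refl refl =
      trans (sym (A-src f n≤2i)) (trans (ev-resp-pwEq i src-f≈tgt-g n≤2i) (A-tgt g n≤2i))

    f≡g-below : ∀ {n} → n < i → E f n ≡ E g n
    f≡g-below n<i =
      compatible (ℕₚ.≤-trans (ℕₚ.<⇒≤ n<i) i≤2i) (s-index-≤ (ℕₚ.<⇒≤ n<i)) (t-index-< n<i)

    f[i]≡g[i+K] : E f i ≡ E g (i + K)
    f[i]≡g[i+K] = compatible i≤2i (s-index-≤ ℕₚ.≤-refl) (t-index-≥ ℕₚ.≤-refl)

    f≡g-above : ∀ {n} → i < n → n ℕ.≤ 2 * i → E f (n + K) ≡ E g (n + K)
    f≡g-above i<n n≤2i = compatible n≤2i (s-index-> i<n) (t-index-≥ (ℕₚ.<⇒≤ i<n))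

    g≤f[i] : ∀ {n} → n ℕ.≤ i + K → E g n ≤ E f i
    g≤f[i] n≤i+K = subst₂ _≤_ refl (sym f[i]≡g[i+K]) (E-mono g n≤i+K)

    f[i]≤f : ∀ {n} → i < n → E f i ≤ E f n
    f[i]≤f i<n = E-mono f (ℕₚ.<⇒≤ i<n)

    summand-≤ : ∀ {n} (i<n : i < n) → n < i + K → (E f n ⊖ E f i) (f[i]≤f i<n) ≤ ⊤⊖ E g n
    summand-≤ i<n n<i+K = ⊖-≤-⊤⊖ (g≤f[i] (ℕₚ.<⇒≤ n<i+K)) (f[i]≤f i<n)

    middleValue : ∀ {n} → i < n → n < i + K → Carrier
    middleValue {n} i<n n<i+K = (E f n ⊖ E f i) (f[i]≤f i<n) ⊕ E g n [ summand-≤ i<n n<i+K ]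

    H : ℕ → Carrier
    H n with band n
    ... | lower _          = E g n
    ... | middle i<n n<i+K = middleValue i<n n<i+K
    ... | upper _          = E f n

    H-lower : ∀ {n} → n ℕ.≤ i → H n ≡ E g n
    H-lower {n} n≤i with band n
    ... | lower _      = refl
    ... | middle i<n _ = ⊥-elim (ℕₚ.<⇒≱ i<n n≤i)
    ... | upper i+K≤n  = ⊥-elim (ℕₚ.<⇒≱ i<i+K (ℕₚ.≤-trans i+K≤n n≤i))

    H-middle : ∀ {n} (i<n : i < n) (n<i+K : n < i + K) → H n ≡ middleValue i<n n<i+K
    H-middle {n} i<n n<i+K with band n
    ... | lower n≤i   = ⊥-elim (ℕₚ.<⇒≱ i<n n≤i)
    ... | middle _ _  = refl
    ... | upper i+K≤n = ⊥-elim (ℕₚ.<⇒≱ n<i+K i+K≤n)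

    H-upper : ∀ {n} → i + K ℕ.≤ n → H n ≡ E f n
    H-upper {n} i+K≤n with band n
    ... | lower n≤i      = ⊥-elim (ℕₚ.<⇒≱ i<i+K (ℕₚ.≤-trans i+K≤n n≤i))
    ... | middle _ n<i+K = ⊥-elim (ℕₚ.<⇒≱ n<i+K i+K≤n)
    ... | upper _        = refl

    H-mono : ∀ {n n′} → n ℕ.≤ n′ → H n ≤ H n′
    H-mono {n} {n′} n≤n′ with band n | band n′
    ... | lower _          | lower _            = E-mono g n≤n′
    ... | lower _          | middle i<n′ n′<i+K =
      ≤-trans (E-mono g n≤n′) (b≤a⊕b (summand-≤ i<n′ n′<i+K))
    ... | lower n≤i        | upper i+K≤n′       =
      ≤-trans (g≤f[i] (ℕₚ.≤-trans n≤i (ℕₚ.<⇒≤ i<i+K))) (E-mono f (ℕₚ.≤-trans (ℕₚ.<⇒≤ i<i+K) i+K≤n′))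
    ... | middle i<n _     | lower n′≤i         = ⊥-elim (ℕₚ.<⇒≱ i<n (ℕₚ.≤-trans n≤n′ n′≤i))
    ... | middle i<n _     | middle i<n′ n′<i+K =
      ⊕-mono-≤ (⊖-monoˡ-≤ (f[i]≤f i<n) (E-mono f n≤n′)) (E-mono g n≤n′) (summand-≤ i<n′ n′<i+K) _
    ... | middle i<n n<i+K | upper _            =
      ≤-trans ([x⊖y]⊕z≤x (g≤f[i] (ℕₚ.<⇒≤ n<i+K)) (f[i]≤f i<n) _) (E-mono f n≤n′)
    ... | upper i+K≤n      | lower n′≤i         =
      ⊥-elim (ℕₚ.<⇒≱ i<i+K (ℕₚ.≤-trans i+K≤n (ℕₚ.≤-trans n≤n′ n′≤i)))
    ... | upper i+K≤n      | middle _ n′<i+K    = ⊥-elim (ℕₚ.<⇒≱ n′<i+K (ℕₚ.≤-trans i+K≤n n≤n′))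
    ... | upper _          | upper _            = E-mono f n≤n′

    composite : C D j
    composite = mk (λ p → H (toℕ p)) (λ _ _ → H-mono)

    composite-spec : CompSpec D i j f g composite
    composite-spec =
        (λ p p≤i → trans (H-lower p≤i) (ev-toℕ j (fun g) p))
      , (λ p i<p p<i+K f[i]≤f[p] →
           IsSum-resp-≡ (⊖-cong (ev-toℕ j (fun f) p) refl _ f[i]≤f[p]) (ev-toℕ j (fun g) p)
                        (sym (H-middle i<p p<i+K)) (⊕-isSum (summand-≤ i<p p<i+K)))
      , (λ p i+K≤p → trans (H-upper i+K≤p) (ev-toℕ j (fun f) p))

    E-lower : ∀ {n} → n ℕ.≤ i → E composite n ≡ E g n
    E-lower n≤i = trans (ev-∘toℕ j H (ℕₚ.≤-trans n≤i (ℕₚ.≤-trans i≤2i 2i≤2j))) (H-lower n≤i)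

    E-middle : ∀ {n} (i<n : i < n) (n<i+K : n < i + K) → E composite n ≡ middleValue i<n n<i+K
    E-middle i<n n<i+K = trans (ev-∘toℕ j H (ℕₚ.≤-trans (ℕₚ.<⇒≤ n<i+K) i+K≤2j)) (H-middle i<n n<i+K)

    E-upper : ∀ {n} → i + K ℕ.≤ n → n ℕ.≤ 2 * j → E composite n ≡ E f n
    E-upper i+K≤n n≤2j = trans (ev-∘toℕ j H n≤2j) (H-upper i+K≤n)

    E-composite∘s-index : ∀ {n} → n ℕ.≤ 2 * i → E composite (s-index n) ≡ E g (s-index n)
    E-composite∘s-index {n} n≤2i with n ≤? i
    ... | yes n≤i = E-lower n≤i
    ... | no n≰i  =
      trans (E-upper (ℕₚ.+-monoˡ-≤ K (ℕₚ.<⇒≤ i<n)) (≤2i⇒+K≤2j n≤2i)) (f≡g-above i<n n≤2i)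
      where i<n = ℕₚ.≰⇒> n≰i

    E-composite∘t-index : ∀ {n} → n ℕ.≤ 2 * i → E composite (t-index n) ≡ E f (t-index n)
    E-composite∘t-index {n} n≤2i with n <? i
    ... | yes n<i = trans (E-lower (ℕₚ.<⇒≤ n<i)) (sym (f≡g-below n<i))
    ... | no n≮i  = E-upper (ℕₚ.+-monoˡ-≤ K (ℕₚ.≮⇒≥ n≮i)) (≤2i⇒+K≤2j n≤2i)

  comp : (f g : C D j) → _≈_ D (src f) (tgt g) → C D j
  comp = Composite.composite

  src-comp : ∀ f g (e : _≈_ D (src f) (tgt g)) → _≈_ D (src (comp f g e)) (src g)
  src-comp f g e = src-cong {comp f g e} {g} (Composite.E-composite∘s-index f g e)

  tgt-comp : ∀ f g (e : _≈_ D (src f) (tgt g)) → _≈_ D (tgt (comp f g e)) (tgt f)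
  tgt-comp f g e = tgt-cong {comp f g e} {f} (Composite.E-composite∘t-index f g e)

  id-right : ∀ f (e : _≈_ D (src f) (tgt (idm (src f)))) → _≈_ D (comp f (idm (src f)) e) f
  id-right f e = pwEq-fromEv j λ {n} n≤2j → on (band n) n≤2j
    where
    open Composite f (idm (src f)) e
    on : ∀ {n} → Band n → n ℕ.≤ 2 * j → E composite n ≡ E f n
    on {n} (lower n≤i) n≤2j = begin
      E composite n                   ≡⟨ E-lower n≤i ⟩
      E (idm (src f)) n               ≡⟨ E-idm∘src f n≤2j ⟩
      E f (s-index (id-index n))      ≡⟨ cong (E f) (s-index∘id-index n≤i) ⟩
      E f n                           ∎
      where open ≡-Reasoning
    on {n} (middle i<n n<i+K) n≤2j = begin
      E composite n                                  ≡⟨ E-middle i<n n<i+K ⟩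
      (E f n ⊖ E f i) _ ⊕ E (idm (src f)) n [ _ ]    ≡⟨ ⊕-cong refl g[n]≡f[i] _ _ ⟩
      (E f n ⊖ E f i) (f[i]≤f i<n) ⊕ E f i [ p ]     ≡⟨ [x⊖b]⊕b≡x (f[i]≤f i<n) p ⟩
      E f n                                          ∎
      where
      open ≡-Reasoning
      g[n]≡f[i] = E-idm∘src-within f (ℕₚ.<⇒≤ i<n) (ℕₚ.<⇒≤ n<i+K) n≤2j
      p = ⊖-≤-⊤⊖ ≤-refl (f[i]≤f i<n)
    on (upper i+K≤n) n≤2j = E-upper i+K≤n n≤2j

  id-left : ∀ f (e : _≈_ D (src (idm (tgt f))) (tgt f)) → _≈_ D (comp (idm (tgt f)) f e) f
  id-left f e = pwEq-fromEv j λ {n} n≤2j → on (band n) n≤2j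
    where
    open Composite (idm (tgt f)) f e
    on : ∀ {n} → Band n → n ℕ.≤ 2 * j → E composite n ≡ E f n
    on (lower n≤i) _ = E-lower n≤i
    on {n} (middle i<n n<i+K) n≤2j = begin
      E composite n                                             ≡⟨ E-middle i<n n<i+K ⟩
      (E (idm (tgt f)) n ⊖ E (idm (tgt f)) i) _ ⊕ E f n [ _ ]   ≡⟨ ⊕-cong F[n]⊖F[i]≡x⊖x refl _ _ ⟩
      (x ⊖ x) ≤-refl ⊕ E f n [ x⊖x≤⊤⊖f[n] ]                     ≡⟨ [x⊖x]⊕b≡b x⊖x≤⊤⊖f[n] ⟩
      E f n                                                     ∎
      where
      open ≡-Reasoning
      x = E f (i + K)
      F[n]⊖F[i]≡x⊖x = ⊖-cong (E-idm∘tgt-within f (ℕₚ.<⇒≤ i<n) (ℕₚ.<⇒≤ n<i+K) n≤2j)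
                              (E-idm∘tgt-within f ℕₚ.≤-refl (ℕₚ.<⇒≤ i<i+K) (ℕₚ.≤-trans i≤2i 2i≤2j))
                              _ ≤-refl
      x⊖x≤⊤⊖f[n] = ⊖-≤-⊤⊖ (E-mono f (ℕₚ.<⇒≤ n<i+K)) ≤-refl
    on {n} (upper i+K≤n) n≤2j = begin
      E composite n                   ≡⟨ E-upper i+K≤n n≤2j ⟩
      E (idm (tgt f)) n               ≡⟨ E-idm∘tgt f n≤2j ⟩
      E f (t-index (id-index n))      ≡⟨ cong (E f) (t-index∘id-index i+K≤n) ⟩
      E f n                           ∎
      where open ≡-Reasoning

  assoc : ∀ f g h (e₁ : _≈_ D (src f) (tgt g)) (e₂ : _≈_ D (src g) (tgt h))
          (e₃ : _≈_ D (src (comp f g e₁)) (tgt h)) (e₄ : _≈_ D (src f) (tgt (comp g h e₂))) →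
          _≈_ D (comp (comp f g e₁) h e₃) (comp f (comp g h e₂) e₄)
  assoc f g h e₁ e₂ e₃ e₄ = pwEq-fromEv j λ {n} n≤2j → on (band n) n≤2j
    where
    module FG = Composite f g e₁
    module GH = Composite g h e₂
    module L = Composite (comp f g e₁) h e₃
    module R = Composite f (comp g h e₂) e₄
    on : ∀ {n} → Band n → n ℕ.≤ 2 * j → E L.composite n ≡ E R.composite n
    on (lower n≤i) _ = trans (L.E-lower n≤i) (sym (trans (R.E-lower n≤i) (GH.E-lower n≤i)))
    on (upper i+K≤n) n≤2j =
      trans (L.E-upper i+K≤n n≤2j) (trans (FG.E-upper i+K≤n n≤2j) (sym (R.E-upper i+K≤n n≤2j)))
    on {n} (middle i<n n<i+K) n≤2j = begin
      E L.composite n                                           ≡⟨ L.E-middle i<n n<i+K ⟩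
      (E (comp f g e₁) n ⊖ E (comp f g e₁) i) _ ⊕ E h n [ _ ]   ≡⟨ ⊕-cong U[n]⊖U[i]≡ refl _ _ ⟩
      ((a ⊕ E g n [ _ ]) ⊖ E g i) _ ⊕ E h n [ _ ]               ≡⟨ ⊕-⊖-⊕-assoc h≤g[i] g[i]≤g a≤⊤⊖g ⟩
      a ⊕ ((E g n ⊖ E g i) _ ⊕ E h n [ _ ]) [ _ ]               ≡⟨ ⊕-cong refl V[n]≡ _ _ ⟩
      a ⊕ E (comp g h e₂) n [ _ ]                               ≡⟨ sym (R.E-middle i<n n<i+K) ⟩
      E R.composite n                                           ∎
      where
      open ≡-Reasoning
      a = (E f n ⊖ E f i) (FG.f[i]≤f i<n)
      a≤⊤⊖g = FG.summand-≤ i<n n<i+K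
      h≤g[i] = GH.g≤f[i] (ℕₚ.<⇒≤ n<i+K)
      g[i]≤g = E-mono g (ℕₚ.<⇒≤ i<n)
      U[n]⊖U[i]≡ = ⊖-cong (FG.E-middle i<n n<i+K) (FG.E-lower ℕₚ.≤-refl) _
                          (≤-trans g[i]≤g (b≤a⊕b a≤⊤⊖g))
      V[n]≡ = sym (GH.E-middle i<n n<i+K)

  isDCategory : IsDCategory D i j
  isDCategory = record
    { src = src ; src-def = λ f → sym ∘ sRaw≗s-index (fun f)
    ; tgt = tgt ; tgt-def = λ f → sym ∘ tRaw≗t-index (fun f)
    ; idm = idm ; idm-def = λ a → sym ∘ IdRaw≗id-index (fun a)
    ; comp = comp ; comp-def = Composite.composite-spec
    ; src-idm = src-idm ; tgt-idm = tgt-idm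
    ; src-comp = src-comp ; tgt-comp = tgt-comp
    ; id-right = id-right ; id-left = id-left
    ; assoc = assoc
    }

mainTheorem11 : ∀ {c ℓ : Level} (D : DPoset c ℓ) (i j : ℕ) → i < j →
    IsDCategory D i j
mainTheorem11 D i j i<j = Construction.isDCategory D i j i<j
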